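{- Let $\mathbbm{k}$ be a field and let $\textsf{ParSym}$ be the $\mathbbm{k}$-vector space with basis $\{\textsf{H}_\pi : \pi \in A_i,\ i \in \mathbb{N}_0\}$, graded by $\textsf{ParSym}_i = \operatorname{span}_{\mathbbm{k}}\{\textsf{H}_\pi : \pi \in A_i\}$, with bilinear product determined by $\textsf{H}_\pi \textsf{H}_\rho = \textsf{H}_{\pi \otimes \rho}$ and unit $\textsf{H}_\varnothing$. Then, as a $\mathbbm{k}$-algebra, $\textsf{ParSym}$ is the free associative $\mathbbm{k}$-algebra on the generators $\textsf{H}_\pi$, $\pi$ ranging over the nonempty $\otimes$-irreducible partition diagrams; in particular it is free with $a_k$ generators in each degree $k \geq 1$, where $a_k$ is the number of nonempty $\otimes$-irreducible diagrams in $A_k$.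
   Context: For $k \geq 0$, a partition diagram of order $k$ is a set partition of $\{1,\ldots,k,1',\ldots,k'\}$; $A_k$ is the set of these, and $A_0=\{\varnothing\}$ (the empty diagram). For $\pi \in A_k$ and $\rho \in A_l$, $\pi \otimes \rho \in A_{k+l}$ is the set partition whose blocks are the blocks of $\pi$ together with the blocks of $\rho$ with every $i$ replaced by $i+k$ and every $i'$ by $(i+k)'$. A diagram is $\otimes$-irreducible if it cannot be written as $\rho^{(1)} \otimes \rho^{(2)}$ with $\rho^{(1)},\rho^{(2)}$ nonempty. -}

module Defs where

open import Level using (Level; _⊔_) renaming (suc to lsuc)
open import Data.Nat using (ℕ; zero; suc; _+_; _≟_)
open import Data.Fin using (Fin; splitAt; _↑ˡ_; _↑ʳ_)
open import Data.Bool using (Bool; true; false; T; _∧_)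
open import Data.Sum using (_⊎_; inj₁; inj₂)
open import Data.Product using (Σ; Σ-syntax; ∃; _×_; _,_; proj₁; proj₂)
open import Data.List using (List; []; _∷_; map; concatMap; foldr; allFin)
open import Data.Empty using (⊥)
open import Relation.Nullary using (¬_; yes; no)
open import Relation.Binary.PropositionalEquality using (_≡_; refl)
open import Algebra.Bundles using (CommutativeRing)

record Field (c ℓ : Level) : Set (lsuc (c ⊔ ℓ)) where
  field
    commRing  : CommutativeRing c ℓ
  open CommutativeRing commRing public
  field
    0≉1       : ¬ (0# ≈ 1#)
    inverse   : ∀ x → ¬ (x ≈ 0#) → Σ Carrier λ y → x * y ≈ 1#

-- The points {1,…,k,1',…,k'} are encoded as Fin (k + k):
--   i ↑ˡ k  (i : Fin k)  is the top point i+1,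
--   k ↑ʳ i  (i : Fin k)  is the bottom point (i+1)'.
-- A set partition is given by its equivalence relation ("same block"),
-- as a Bool-valued relation that is reflexive, symmetric and transitive.

BRel : ℕ → Set
BRel n = Fin n → Fin n → Bool

record IsEquivB {n : ℕ} (R : BRel n) : Set where
  field
    reflB  : ∀ i → T (R i i)
    symB   : ∀ i j → T (R i j) → T (R j i)
    transB : ∀ i j l → T (R i j) → T (R j l) → T (R i l)

Diagram : ℕ → Set
Diagram k = Σ (BRel (k + k)) IsEquivB

ADiag : Set
ADiag = Σ ℕ Diagram

order : ADiag → ℕ
order = proj₁

data _≐_ : ADiag → ADiag → Set where
  same : ∀ {k} {π ρ : Diagram k} →
         (∀ i j → proj₁ π i j ≡ proj₁ ρ i j) → (k , π) ≐ (k , ρ)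

eqRelB : ∀ {n} → BRel n → BRel n → Bool
eqRelB {n} R S = allB (λ i → allB (λ j → eqB (R i j) (S i j)) (allFin n)) (allFin n)
  where
  allB : {A : Set} → (A → Bool) → List A → Bool
  allB f [] = true
  allB f (a ∷ as) = f a ∧ allB f as
  eqB : Bool → Bool → Bool
  eqB true true = true
  eqB false false = true
  eqB _ _ = false

eqADiag : ADiag → ADiag → Bool
eqADiag (k , π) (k' , ρ) with k ≟ k'
... | yes refl = eqRelB (proj₁ π) (proj₁ ρ)
... | no _ = false

∅D : Diagram 0
∅D = (λ ()) , record { reflB = λ () ; symB = λ () ; transB = λ () }

-- Which factor / which point a point of π ⊗ ρ comes from.
-- Top point a of order k+l: a < k → top a of π; otherwise top (a-k) of ρ;
-- bottom points likewise.
part : ∀ k l → Fin ((k + l) + (k + l)) → Fin (k + k) ⊎ Fin (l + l)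
part k l p with splitAt (k + l) p
... | inj₁ a with splitAt k a
...   | inj₁ i = inj₁ (i ↑ˡ k)
...   | inj₂ j = inj₂ (j ↑ˡ l)
part k l p | inj₂ a with splitAt k a
...   | inj₁ i = inj₁ (k ↑ʳ i)
...   | inj₂ j = inj₂ (l ↑ʳ j)

combine : ∀ {m n} → BRel m → BRel n → (Fin m ⊎ Fin n) → (Fin m ⊎ Fin n) → Bool
combine R S (inj₁ a) (inj₁ b) = R a b
combine R S (inj₂ a) (inj₂ b) = S a b
combine R S _ _ = false

tensorRel : ∀ {k l} → BRel (k + k) → BRel (l + l) → BRel ((k + l) + (k + l))
tensorRel {k} {l} R S p q = combine R S (part k l p) (part k l q)

module _ {m n : ℕ} {R : BRel m} {S : BRel n} (eR : IsEquivB R) (eS : IsEquivB S) where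
  private
    module ER = IsEquivB eR
    module ES = IsEquivB eS

  combine-refl : ∀ x → T (combine R S x x)
  combine-refl (inj₁ a) = ER.reflB a
  combine-refl (inj₂ a) = ES.reflB a

  combine-sym : ∀ x y → T (combine R S x y) → T (combine R S y x)
  combine-sym (inj₁ a) (inj₁ b) h = ER.symB a b h
  combine-sym (inj₂ a) (inj₂ b) h = ES.symB a b h

  combine-trans : ∀ x y z → T (combine R S x y) → T (combine R S y z) → T (combine R S x z)
  combine-trans (inj₁ a) (inj₁ b) (inj₁ c) h g = ER.transB a b c h g
  combine-trans (inj₂ a) (inj₂ b) (inj₂ c) h g = ES.transB a b c h g

_⊗_ : ∀ {k l} → Diagram k → Diagram l → Diagram (k + l)
_⊗_ {k} {l} (R , eR) (S , eS) =
  tensorRel {k} {l} R S ,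
  record { reflB  = λ p → combine-refl eR eS (part k l p)
         ; symB   = λ p q → combine-sym eR eS (part k l p) (part k l q)
         ; transB = λ p q r → combine-trans eR eS (part k l p) (part k l q) (part k l r) }

_⊗A_ : ADiag → ADiag → ADiag
(k , π) ⊗A (l , ρ) = (k + l) , (_⊗_ {k} {l} π ρ)

∅A : ADiag
∅A = 0 , ∅D

Nonempty : ADiag → Set
Nonempty (zero , _) = ⊥
Nonempty (suc _ , _) = Data.Unit.⊤
  where import Data.Unit

Irreducible : ADiag → Set
Irreducible π = ¬ (Σ ADiag λ ρ₁ → Σ ADiag λ ρ₂ →
                     Nonempty ρ₁ × Nonempty ρ₂ × (π ≐ (ρ₁ ⊗A ρ₂)))

Gen : Set
Gen = Σ ADiag λ π → Nonempty π × Irreducible π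

-- An element of the k-vector space with basis B is represented by a finite
-- formal sum Σ cᵢ bᵢ (a list of pairs); two such are equal iff all
-- coefficients agree.  `eqB` is a boolean test for equality of basis elements.

module FreeVS {c ℓ : Level} (K : Field c ℓ) (B : Set) (eqB : B → B → Bool) where
  open Field K using (Carrier; _≈_; 0#; 1#) renaming (_+_ to _+K_; _*_ to _*K_)

  Vec : Set c
  Vec = List (Carrier × B)

  coeff : Vec → B → Carrier
  coeff [] b = 0#
  coeff ((x , b') ∷ v) b with eqB b b'
  ... | true  = x +K coeff v b
  ... | false = coeff v b

  _≈V_ : Vec → Vec → Set ℓ
  v ≈V w = ∀ b → coeff v b ≈ coeff w b

  _+V_ : Vec → Vec → Vec
  v +V w = Data.List._++_ v w

  _·V_ : Carrier → Vec → Vec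
  x ·V v = map (λ p → (x *K proj₁ p , proj₂ p)) v

  mulWith : (B → B → B) → Vec → Vec → Vec
  mulWith m v w = concatMap (λ p → map (λ q → (proj₁ p *K proj₁ q , m (proj₂ p) (proj₂ q))) w) v

  linExt : {B' : Set} → (B → B') → Vec → List (Carrier × B')
  linExt f = map (λ p → (proj₁ p , f (proj₂ p)))

module Setup {c ℓ : Level} (K : Field c ℓ) where
  open Field K using (Carrier; 1#)

  module PS = FreeVS K ADiag eqADiag

  ParSym : Set c
  ParSym = PS.Vec

  H : ADiag → ParSym
  H π = (1# , π) ∷ []

  _*P_ : ParSym → ParSym → ParSym
  _*P_ = PS.mulWith _⊗A_

  1P : ParSym
  1P = H ∅A

  -- the free associative algebra k⟨x_g : g ∈ Gen⟩: basis = words in Gen,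
  -- product = concatenation, unit = empty word
  Word : Set
  Word = List Gen

  eqWord : Word → Word → Bool
  eqWord [] [] = true
  eqWord (g ∷ u) (h ∷ w) = eqADiag (proj₁ g) (proj₁ h) ∧ eqWord u w
  eqWord _ _ = false

  module FA = FreeVS K Word eqWord

  FreeAlg : Set c
  FreeAlg = FA.Vec

  x : Gen → FreeAlg
  x g = (1# , g ∷ []) ∷ []

  _*F_ : FreeAlg → FreeAlg → FreeAlg
  _*F_ = FA.mulWith Data.List._++_

  1F : FreeAlg
  1F = (1# , []) ∷ []

  evalWord : Word → ADiag
  evalWord = foldr (λ g d → proj₁ g ⊗A d) ∅A

  Φ : FreeAlg → ParSym
  Φ = FA.linExt evalWord

{-# OPTIONS --safe #-}
-- Record a diagram of order k by its block relation on the points (i, s), i < k, s : Bool.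
-- Then ⊗ is juxtaposition of block relations, and a diagram is a product of two nonempty
-- diagrams exactly when some 0 < j < k splits it: no block meets both the first j columns
-- and the remaining ones.  Splitting while possible factors every diagram into irreducible
-- ones, and the factorisation is unique because the first factor is forced: a shorter first
-- factor of one factorisation would split the irreducible first factor of the other.  So
-- evaluation of words in irreducible diagrams is a bijection onto diagrams, turning
-- concatenation into ⊗; on bases this is Φ, which is therefore an algebra isomorphism.
module Submission where

open import Defs
open import Level using (Level; 0ℓ)
open import Data.Bool using (Bool; true; false; T; _∧_)
open import Data.Bool.Properties using (⇔→≡) renaming (_≟_ to _≟ᵇ_)
open import Data.Empty using (⊥-elim)
open import Data.Fin as F using (Fin; splitAt; _↑ˡ_; _↑ʳ_; toℕ; fromℕ<)
import Data.Fin.Properties as FP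
open import Data.List using (List; []; _∷_; tabulate; allFin; map; foldr; _++_)
open import Data.List.Membership.Propositional using (_∈_)
open import Data.List.Membership.Propositional.Properties using (∈-allFin)
open import Data.List.Properties using (map-++)
open import Data.List.Relation.Binary.Pointwise as PW using (Pointwise; []; _∷_)
open import Data.List.Relation.Unary.Any using (here; there)
open import Data.Nat using (ℕ; zero; suc; _+_; _∸_; _<_; _≤_; _<?_; _≤?_; z≤n; s≤s; _≟_)
open import Data.Nat.Induction using (<-rec)
open import Data.Nat.Properties
open import Data.Product using (Σ; ∃-syntax; _×_; _,_; proj₁; proj₂)
open import Data.Sum using (inj₁; inj₂)
open import Data.Unit using (tt)
open import Function using (_⇔_; mk⇔; Equivalence; _∘_; _∘₂_)
open import Function.Properties.Equivalence using (⇔-setoid) renaming (trans to ⇔-trans)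
open import Relation.Binary.Bundles using (Setoid)
open import Relation.Binary.Definitions using (Tri; tri<; tri≈; tri>)
open import Relation.Binary.PropositionalEquality
import Relation.Binary.Reasoning.Setoid as SetoidReasoning
open import Relation.Nullary using (¬_; yes; no; Dec)
open import Relation.Nullary.Decidable using (map′; _×-dec_; _→-dec_)

-- Equality tests of diagrams

-- The helpers of eqRelB are local to its where block.  They are named here by solving a
-- metavariable against the normal form of eqRelB R S, after abstracting the subterms that
-- keep the unification problem from being a pattern (the first witness only holds when
-- m = 0, but it is the solution of the metavariable that is needed, not the equation).
module _ {m : ℕ} (R S : BRel (suc m)) where
  private
    eqᵇ-witness : Σ (Bool → Bool → Bool) λ eqᵇ → tabulate {n = m} (λ x → F.suc x) ≡ [] →
      ((eqᵇ (R F.zero F.zero) (S F.zero F.zero) ∧ true) ∧ true) ≡ eqRelB R S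
    eqᵇ-witness = eqᵇ₀ , solve
      where
      eqᵇ₀ : Bool → Bool → Bool
      eqᵇ₀ = _
      solve : tabulate {n = m} (λ x → F.suc x) ≡ [] →
        ((eqᵇ₀ (R F.zero F.zero) (S F.zero F.zero) ∧ true) ∧ true) ≡ eqRelB R S
      solve e with tabulate {n = m} (λ x → F.suc x) | e
      ... | .[] | refl with R F.zero F.zero | S F.zero F.zero
      ...   | _ | _ = refl

    eqᵇ : Bool → Bool → Bool
    eqᵇ = proj₁ eqᵇ-witness

    allᵇ-witness : Σ ((Fin (suc m) → Bool) → List (Fin (suc m)) → Bool) λ allᵇ → Σ Bool λ b →
      ((eqᵇ (R F.zero F.zero) (S F.zero F.zero) ∧
        allᵇ (λ j → eqᵇ (R F.zero j) (S F.zero j)) (tabulate {n = m} (λ x → F.suc x))) ∧ b) ≡ eqRelB R S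
    allᵇ-witness = allᵇ₀ , solve
      where
      allᵇ₀ : (Fin (suc m) → Bool) → List (Fin (suc m)) → Bool
      allᵇ₀ = _
      solve : Σ Bool λ b →
        ((eqᵇ (R F.zero F.zero) (S F.zero F.zero) ∧
          allᵇ₀ (λ j → eqᵇ (R F.zero j) (S F.zero j)) (tabulate {n = m} (λ x → F.suc x))) ∧ b) ≡ eqRelB R S
      solve with (λ j → eqᵇ (R F.zero j) (S F.zero j)) | tabulate {n = m} (λ x → F.suc x)
      ... | f | l = _ , refl

    allᵇ : (Fin (suc m) → Bool) → List (Fin (suc m)) → Bool
    allᵇ = proj₁ allᵇ-witness

    allᵇ-complete : ∀ f → (∀ a → f a ≡ true) → ∀ l → allᵇ f l ≡ true
    allᵇ-complete f all-f [] = refl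
    allᵇ-complete f all-f (a ∷ l) rewrite all-f a = allᵇ-complete f all-f l

    allᵇ-sound : ∀ f l → allᵇ f l ≡ true → ∀ {a} → a ∈ l → f a ≡ true
    allᵇ-sound f (b ∷ l) h (here refl) with f b
    ... | true = refl
    allᵇ-sound f (b ∷ l) h (there a∈l) with f b
    ... | true = allᵇ-sound f l h a∈l

    eqᵇ-sound : ∀ b c → eqᵇ b c ≡ true → b ≡ c
    eqᵇ-sound true true _ = refl
    eqᵇ-sound false false _ = refl

    eqᵇ-refl : ∀ b → eqᵇ b b ≡ true
    eqᵇ-refl true = refl
    eqᵇ-refl false = refl

  eqRelB⇔pointwiseₛ : eqRelB R S ≡ true ⇔ (∀ p q → R p q ≡ S p q)
  eqRelB⇔pointwiseₛ = mk⇔ sound complete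
    where
    sound : eqRelB R S ≡ true → ∀ p q → R p q ≡ S p q
    sound h p q = eqᵇ-sound _ _ (allᵇ-sound _ _ (allᵇ-sound _ _ h (∈-allFin p)) (∈-allFin q))
    complete : (∀ p q → R p q ≡ S p q) → eqRelB R S ≡ true
    complete h = allᵇ-complete _ (λ p → allᵇ-complete _ (λ q →
      subst (λ b → eqᵇ (R p q) b ≡ true) (h p q) (eqᵇ-refl (R p q))) (allFin (suc m))) (allFin (suc m))

eqRelB⇔pointwise : ∀ {n} (R S : BRel n) → eqRelB R S ≡ true ⇔ (∀ p q → R p q ≡ S p q)
eqRelB⇔pointwise {zero} R S = mk⇔ (λ _ ()) (λ _ → refl)
eqRelB⇔pointwise {suc m} = eqRelB⇔pointwiseₛ

eqADiag⇔≐ : ∀ X Y → eqADiag X Y ≡ true ⇔ X ≐ Y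
eqADiag⇔≐ (k , R , _) (k′ , S , _) with k ≟ k′
... | yes refl = mk⇔ (λ h → same (Equivalence.to (eqRelB⇔pointwise R S) h))
                     (λ { (same h) → Equivalence.from (eqRelB⇔pointwise R S) h })
... | no k≢k′ = mk⇔ (λ ()) (λ { (same _) → ⊥-elim (k≢k′ refl) })

-- Diagrams as block relations on points

point : ∀ k {i} → .(i < k) → Bool → Fin (k + k)
point k i<k false = fromℕ< i<k ↑ˡ k
point k i<k true = k ↑ʳ fromℕ< i<k

point-surjective : ∀ k (p : Fin (k + k)) → ∃[ i ] Σ (i < k) λ i<k → ∃[ s ] point k i<k s ≡ p
point-surjective k p with splitAt k p in eq
... | inj₁ a = toℕ a , FP.toℕ<n a , false ,
  trans (cong (_↑ˡ k) (FP.fromℕ<-toℕ a (FP.toℕ<n a))) (FP.splitAt⁻¹-↑ˡ eq)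
... | inj₂ a = toℕ a , FP.toℕ<n a , true ,
  trans (cong (k ↑ʳ_) (FP.fromℕ<-toℕ a (FP.toℕ<n a))) (FP.splitAt⁻¹-↑ʳ eq)

coord : ∀ k → Fin (k + k) → ℕ × Bool
coord k p with splitAt k p
... | inj₁ a = toℕ a , false
... | inj₂ a = toℕ a , true

coord-bound : ∀ k p → proj₁ (coord k p) < k
coord-bound k p with splitAt k p
... | inj₁ a = FP.toℕ<n a
... | inj₂ a = FP.toℕ<n a

coord-point : ∀ k {i} (i<k : i < k) s → coord k (point k i<k s) ≡ (i , s)
coord-point k i<k false rewrite FP.splitAt-↑ˡ k (fromℕ< i<k) k = cong (_, false) (FP.toℕ-fromℕ< i<k)
coord-point k i<k true rewrite FP.splitAt-↑ʳ k k (fromℕ< i<k) = cong (_, true) (FP.toℕ-fromℕ< i<k)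

-- A i s j t: the points (i, s) and (j, t) lie in one block, where s = false is the top row
-- and s = true the bottom row.  Relations of diagrams of every order live in this one type.
PtRel : Set
PtRel = ℕ → Bool → ℕ → Bool → Bool

infix 4 _≋_
_≋_ : PtRel → PtRel → Set
A ≋ B = ∀ i s j t → A i s j t ≡ B i s j t

≋-setoid : Setoid 0ℓ 0ℓ
≋-setoid = record
  { Carrier = PtRel
  ; _≈_ = _≋_
  ; isEquivalence = record
    { refl = λ _ _ _ _ → refl
    ; sym = λ e i s j t → sym (e i s j t)
    ; trans = λ e f i s j t → trans (e i s j t) (f i s j t) } }

open Setoid ≋-setoid public using () renaming (refl to ≋-refl; sym to ≋-sym; trans to ≋-trans)

module ≋-Reasoning = SetoidReasoning ≋-setoid
module ⇔-Reasoning = SetoidReasoning (⇔-setoid 0ℓ)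

∅ᴿ : PtRel
∅ᴿ _ _ _ _ = false

record IsDiagRel (m : ℕ) (A : PtRel) : Set where
  field
    reflexive  : ∀ {i} s → i < m → T (A i s i s)
    symmetric  : ∀ {i j} s t → T (A i s j t) → T (A j t i s)
    transitive : ∀ {i j l} s t u → T (A i s j t) → T (A j t l u) → T (A i s l u)
    supported  : ∀ {i j} s t → T (A i s j t) → i < m

  supportedʳ : ∀ {i j} s t → T (A i s j t) → j < m
  supportedʳ s t h = supported t s (symmetric s t h)

  outsideˡ : ∀ {i j} s t → ¬ i < m → A i s j t ≡ false
  outsideˡ {i} {j} s t i≮m with A i s j t in eq
  ... | true = ⊥-elim (i≮m (supported s t (subst T (sym eq) tt)))
  ... | false = refl

  outsideʳ : ∀ {i j} s t → ¬ j < m → A i s j t ≡ false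
  outsideʳ {i} {j} s t j≮m with A i s j t in eq
  ... | true = ⊥-elim (j≮m (supportedʳ s t (subst T (sym eq) tt)))
  ... | false = refl

isDiagRel-resp : ∀ {m A B} → A ≋ B → IsDiagRel m A → IsDiagRel m B
isDiagRel-resp {m} {A} {B} e isA = record
  { reflexive = λ s i<m → to (reflexive s i<m)
  ; symmetric = λ s t h → to (symmetric s t (from h))
  ; transitive = λ s t u h g → to (transitive s t u (from h) (from g))
  ; supported = λ s t h → supported s t (from h) }
  where
  open IsDiagRel isA
  to : ∀ {i s j t} → T (A i s j t) → T (B i s j t)
  to {i} {s} {j} {t} = subst T (e i s j t)
  from : ∀ {i s j t} → T (B i s j t) → T (A i s j t)
  from {i} {s} {j} {t} = subst T (sym (e i s j t))

isDiagRel-order-unique : ∀ {m m′ A} → IsDiagRel m A → IsDiagRel m′ A → m ≡ m′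
isDiagRel-order-unique {m} {m′} isA isA′ with <-cmp m m′
... | tri≈ _ m≡m′ _ = m≡m′
... | tri< m<m′ _ _ = ⊥-elim (<-irrefl refl (IsDiagRel.supported isA false false (IsDiagRel.reflexive isA′ false m<m′)))
... | tri> _ _ m′<m = ⊥-elim (<-irrefl refl (IsDiagRel.supported isA′ false false (IsDiagRel.reflexive isA false m′<m)))

isDiagRel-∅ : ∀ {A} → IsDiagRel 0 A → A ≋ ∅ᴿ
isDiagRel-∅ isA i s j t = IsDiagRel.outsideˡ isA s t λ ()

rel : ADiag → PtRel
rel (k , R , _) i s j t with i <? k | j <? k
... | yes i<k | yes j<k = R (point k i<k s) (point k j<k t)
... | _       | _       = false

rel-inside : ∀ k R e {i j} s t (i<k : i < k) (j<k : j < k) →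
             rel (k , R , e) i s j t ≡ R (point k i<k s) (point k j<k t)
rel-inside k R e {i} {j} s t i<k j<k with i <? k | j <? k
... | yes _    | yes _    = refl
... | no i≮k   | _        = ⊥-elim (i≮k i<k)
... | yes _    | no j≮k   = ⊥-elim (j≮k j<k)

rel-supported : ∀ k R e {i j} s t → T (rel (k , R , e) i s j t) → i < k × j < k
rel-supported k R e {i} {j} s t h with i <? k | j <? k
... | yes i<k | yes j<k = i<k , j<k

rel-isDiagRel : ∀ X → IsDiagRel (order X) (rel X)
rel-isDiagRel (k , R , e) = record
  { reflexive = λ s i<k → subst T (sym (rel-inside k R e s s i<k i<k)) (E.reflB _)
  ; symmetric = λ s t h →
      let (i<k , j<k) = rel-supported k R e s t h in
      inside-to j<k i<k (E.symB _ _ (inside-from i<k j<k h))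
  ; transitive = λ s t u h g →
      let (i<k , j<k) = rel-supported k R e s t h ; (_ , l<k) = rel-supported k R e t u g in
      inside-to i<k l<k (E.transB _ _ _ (inside-from i<k j<k h) (inside-from j<k l<k g))
  ; supported = λ s t h → proj₁ (rel-supported k R e s t h) }
  where
  module E = IsEquivB e
  inside-to : ∀ {i j s t} (i<k : i < k) (j<k : j < k) →
              T (R (point k i<k s) (point k j<k t)) → T (rel (k , R , e) i s j t)
  inside-to {s = s} {t = t} i<k j<k = subst T (sym (rel-inside k R e s t i<k j<k))
  inside-from : ∀ {i j s t} (i<k : i < k) (j<k : j < k) →
                T (rel (k , R , e) i s j t) → T (R (point k i<k s) (point k j<k t))
  inside-from {s = s} {t = t} i<k j<k = subst T (rel-inside k R e s t i<k j<k)

rel-outsideˡ : ∀ X {i j} s t → ¬ i < order X → rel X i s j t ≡ false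
rel-outsideˡ X = IsDiagRel.outsideˡ (rel-isDiagRel X)

rel-outsideʳ : ∀ X {i j} s t → ¬ j < order X → rel X i s j t ≡ false
rel-outsideʳ X = IsDiagRel.outsideʳ (rel-isDiagRel X)

infix 4 _≈ᴰ_
_≈ᴰ_ : ADiag → ADiag → Set
X ≈ᴰ Y = rel X ≋ rel Y

order-resp : ∀ {X Y} → X ≈ᴰ Y → order X ≡ order Y
order-resp {X} {Y} e = isDiagRel-order-unique (rel-isDiagRel X) (isDiagRel-resp (≋-sym e) (rel-isDiagRel Y))

isDiagRel-order : ∀ {m A} X → IsDiagRel m A → A ≋ rel X → order X ≡ m
isDiagRel-order X isA e = isDiagRel-order-unique (rel-isDiagRel X) (isDiagRel-resp e isA)

rel-ext : ∀ k R e S e′ →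
          (∀ {i j} s t (i<k : i < k) (j<k : j < k) → R (point k i<k s) (point k j<k t) ≡ S (point k i<k s) (point k j<k t)) →
          (k , R , e) ≈ᴰ (k , S , e′)
rel-ext k R e S e′ h i s j t with i <? k | j <? k
... | yes i<k | yes j<k = h s t i<k j<k
... | yes _   | no _    = refl
... | no _    | _       = refl

≐⇔≈ᴰ : ∀ X Y → X ≐ Y ⇔ X ≈ᴰ Y
≐⇔≈ᴰ X Y = mk⇔ to (from X Y)
  where
  to : ∀ {X Y} → X ≐ Y → X ≈ᴰ Y
  to {k , R , e} {.k , S , e′} (same f) = rel-ext k R e S e′ λ _ _ _ _ → f _ _
  from : ∀ X Y → X ≈ᴰ Y → X ≐ Y
  from (k , R , e) (k′ , S , e′) h with order-resp {k , R , e} {k′ , S , e′} h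
  ... | refl = same pointwise
    where
    pointwise : ∀ p q → R p q ≡ S p q
    pointwise p q with point-surjective k p | point-surjective k q
    ... | i , i<k , s , refl | j , j<k , t , refl =
      trans (sym (rel-inside k R e s t i<k j<k)) (trans (h i s j t) (rel-inside k S e′ s t i<k j<k))

eqADiag⇔≈ᴰ : ∀ X Y → eqADiag X Y ≡ true ⇔ X ≈ᴰ Y
eqADiag⇔≈ᴰ X Y = ⇔-trans (eqADiag⇔≐ X Y) (≐⇔≈ᴰ X Y)

uncurryRel : PtRel → ℕ × Bool → ℕ × Bool → Bool
uncurryRel A (i , s) (j , t) = A i s j t

diagramOf : ∀ {m A} → IsDiagRel m A → Diagram m
diagramOf {m} {A} isA = (λ p q → uncurryRel A (coord m p) (coord m q)) , record
  { reflB = λ p → reflexive _ (coord-bound m p)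
  ; symB = λ p q → symmetric _ _
  ; transB = λ p q r → transitive _ _ _ }
  where open IsDiagRel isA

rel-diagramOf : ∀ {m A} (isA : IsDiagRel m A) → rel (m , diagramOf isA) ≋ A
rel-diagramOf {m} {A} isA i s j t with i <? m | j <? m
... | yes i<m | yes j<m = cong₂ (uncurryRel A) (coord-point m i<m s) (coord-point m j<m t)
... | yes _   | no j≮m  = sym (IsDiagRel.outsideʳ isA s t j≮m)
... | no i≮m  | _       = sym (IsDiagRel.outsideˡ isA s t i≮m)

-- Tensor product of block relations

infixr 6 _⊗⟨_⟩_
_⊗⟨_⟩_ : PtRel → ℕ → PtRel → PtRel
(A ⊗⟨ k ⟩ B) i s j t with i <? k | j <? k
... | yes _ | yes _ = A i s j t
... | no _  | no _  = B (i ∸ k) s (j ∸ k) t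
... | _     | _     = false

module _ {k : ℕ} (A B : PtRel) {i j : ℕ} {s t : Bool} where

  ⊗-left : i < k → j < k → (A ⊗⟨ k ⟩ B) i s j t ≡ A i s j t
  ⊗-left i<k j<k with i <? k | j <? k
  ... | yes _ | yes _ = refl
  ... | no i≮k | _ = ⊥-elim (i≮k i<k)
  ... | yes _ | no j≮k = ⊥-elim (j≮k j<k)

  ⊗-right : k ≤ i → k ≤ j → (A ⊗⟨ k ⟩ B) i s j t ≡ B (i ∸ k) s (j ∸ k) t
  ⊗-right k≤i k≤j with i <? k | j <? k
  ... | no _ | no _ = refl
  ... | yes i<k | _ = ⊥-elim (<⇒≱ i<k k≤i)
  ... | no _ | yes j<k = ⊥-elim (<⇒≱ j<k k≤j)

  ⊗-across : i < k → k ≤ j → (A ⊗⟨ k ⟩ B) i s j t ≡ false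
  ⊗-across i<k k≤j with i <? k | j <? k
  ... | yes _ | no _ = refl
  ... | no i≮k | _ = ⊥-elim (i≮k i<k)
  ... | yes _ | yes j<k = ⊥-elim (<⇒≱ j<k k≤j)

  ⊗-across′ : k ≤ i → j < k → (A ⊗⟨ k ⟩ B) i s j t ≡ false
  ⊗-across′ k≤i j<k with i <? k | j <? k
  ... | no _ | yes _ = refl
  ... | yes i<k | _ = ⊥-elim (<⇒≱ i<k k≤i)
  ... | no _ | no j≮k = ⊥-elim (j≮k j<k)

⊗-cong : ∀ k {A A′ B B′} → A ≋ A′ → B ≋ B′ → A ⊗⟨ k ⟩ B ≋ A′ ⊗⟨ k ⟩ B′
⊗-cong k eA eB i s j t with i <? k | j <? k
... | yes _ | yes _ = eA i s j t
... | no _  | no _  = eB (i ∸ k) s (j ∸ k) t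
... | yes _ | no _  = refl
... | no _  | yes _ = refl

m∸n<o⇒m<n+o : ∀ {i k l} → i ∸ k < l → i < k + l
m∸n<o⇒m<n+o {i} {k} {l} i∸k<l = ≤-<-trans (m≤n+m∸n i k) (+-monoʳ-< k i∸k<l)

n≤m⇒m<n+o⇒m∸n<o : ∀ {i k l} → k ≤ i → i < k + l → i ∸ k < l
n≤m⇒m<n+o⇒m∸n<o {i} {k} {l} k≤i i<k+l = subst (i ∸ k <_) (m+n∸m≡n k l) (∸-monoˡ-< i<k+l k≤i)

fromℕ<-↑ˡ : ∀ {k l i} (i<k+l : i < k + l) (i<k : i < k) → fromℕ< i<k+l ≡ fromℕ< i<k ↑ˡ l
fromℕ<-↑ˡ {k} {l} i<k+l i<k = FP.toℕ-injective
  (trans (FP.toℕ-fromℕ< i<k+l) (sym (trans (FP.toℕ-↑ˡ (fromℕ< i<k) l) (FP.toℕ-fromℕ< i<k))))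

fromℕ<-↑ʳ : ∀ {k l i} (i<k+l : i < k + l) (k≤i : k ≤ i) (i∸k<l : i ∸ k < l) →
            fromℕ< i<k+l ≡ k ↑ʳ fromℕ< i∸k<l
fromℕ<-↑ʳ {k} {l} i<k+l k≤i i∸k<l = FP.toℕ-injective
  (trans (FP.toℕ-fromℕ< i<k+l)
    (sym (trans (FP.toℕ-↑ʳ k (fromℕ< i∸k<l))
                (trans (cong (k +_) (FP.toℕ-fromℕ< i∸k<l)) (m+[n∸m]≡n k≤i)))))

part-left : ∀ k l {i} (i<k+l : i < k + l) (i<k : i < k) s →
            part k l (point (k + l) i<k+l s) ≡ inj₁ (point k i<k s)
part-left k l i<k+l i<k false
  rewrite FP.splitAt-↑ˡ (k + l) (fromℕ< i<k+l) (k + l) | fromℕ<-↑ˡ {k} {l} i<k+l i<k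
        | FP.splitAt-↑ˡ k (fromℕ< i<k) l = refl
part-left k l i<k+l i<k true
  rewrite FP.splitAt-↑ʳ (k + l) (k + l) (fromℕ< i<k+l) | fromℕ<-↑ˡ {k} {l} i<k+l i<k
        | FP.splitAt-↑ˡ k (fromℕ< i<k) l = refl

part-right : ∀ k l {i} (i<k+l : i < k + l) (k≤i : k ≤ i) s →
             part k l (point (k + l) i<k+l s) ≡ inj₂ (point l (n≤m⇒m<n+o⇒m∸n<o k≤i i<k+l) s)
part-right k l i<k+l k≤i false
  rewrite FP.splitAt-↑ˡ (k + l) (fromℕ< i<k+l) (k + l)
        | fromℕ<-↑ʳ {k} {l} i<k+l k≤i (n≤m⇒m<n+o⇒m∸n<o k≤i i<k+l)
        | FP.splitAt-↑ʳ k l (fromℕ< (n≤m⇒m<n+o⇒m∸n<o k≤i i<k+l)) = refl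
part-right k l i<k+l k≤i true
  rewrite FP.splitAt-↑ʳ (k + l) (k + l) (fromℕ< i<k+l)
        | fromℕ<-↑ʳ {k} {l} i<k+l k≤i (n≤m⇒m<n+o⇒m∸n<o k≤i i<k+l)
        | FP.splitAt-↑ʳ k l (fromℕ< (n≤m⇒m<n+o⇒m∸n<o k≤i i<k+l)) = refl

rel-⊗ : ∀ X Y → rel (X ⊗A Y) ≋ rel X ⊗⟨ order X ⟩ rel Y
rel-⊗ X@(k , R , e) Y@(l , S , e′) i s j t = byBlocks (i <? k) (j <? k)
  where
  XY = X ⊗A Y
  open ≡-Reasoning

  widen : ∀ {x} → x < k → x < k + l
  widen x<k = <-≤-trans x<k (m≤m+n k l)

  narrow : ∀ {x} → k ≤ x → x < k + l → x ∸ k < l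
  narrow = n≤m⇒m<n+o⇒m∸n<o

  inside : (i<k+l : i < k + l) (j<k+l : j < k + l) →
           rel XY i s j t ≡ combine R S (part k l (point (k + l) i<k+l s)) (part k l (point (k + l) j<k+l t))
  inside = rel-inside (k + l) (tensorRel {k} {l} R S) (proj₂ (proj₂ XY)) s t

  leftBlock : i < k → j < k → rel XY i s j t ≡ rel X i s j t
  leftBlock i<k j<k = begin
    rel XY i s j t
      ≡⟨ inside (widen i<k) (widen j<k) ⟩
    combine R S (part k l (point (k + l) (widen i<k) s)) (part k l (point (k + l) (widen j<k) t))
      ≡⟨ cong₂ (combine R S) (part-left k l (widen i<k) i<k s) (part-left k l (widen j<k) j<k t) ⟩
    R (point k i<k s) (point k j<k t)
      ≡⟨ rel-inside k R e s t i<k j<k ⟨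
    rel X i s j t
      ∎

  rightBlock : k ≤ i → k ≤ j → Dec (i < k + l) → Dec (j < k + l) → rel XY i s j t ≡ rel Y (i ∸ k) s (j ∸ k) t
  rightBlock k≤i k≤j (yes i<k+l) (yes j<k+l) = begin
    rel XY i s j t
      ≡⟨ inside i<k+l j<k+l ⟩
    combine R S (part k l (point (k + l) i<k+l s)) (part k l (point (k + l) j<k+l t))
      ≡⟨ cong₂ (combine R S) (part-right k l i<k+l k≤i s) (part-right k l j<k+l k≤j t) ⟩
    S (point l (narrow k≤i i<k+l) s) (point l (narrow k≤j j<k+l) t)
      ≡⟨ rel-inside l S e′ s t (narrow k≤i i<k+l) (narrow k≤j j<k+l) ⟨
    rel Y (i ∸ k) s (j ∸ k) t
      ∎
  rightBlock _ _ (no i≮k+l) _ =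
    trans (rel-outsideˡ XY s t i≮k+l) (sym (rel-outsideˡ Y s t (i≮k+l ∘ m∸n<o⇒m<n+o)))
  rightBlock _ _ (yes _) (no j≮k+l) =
    trans (rel-outsideʳ XY s t j≮k+l) (sym (rel-outsideʳ Y s t (j≮k+l ∘ m∸n<o⇒m<n+o)))

  across : i < k → k ≤ j → Dec (j < k + l) → rel XY i s j t ≡ false
  across i<k k≤j (yes j<k+l) = trans (inside (widen i<k) j<k+l)
    (cong₂ (combine R S) (part-left k l (widen i<k) i<k s) (part-right k l j<k+l k≤j t))
  across _ _ (no j≮k+l) = rel-outsideʳ XY s t j≮k+l

  across′ : k ≤ i → j < k → Dec (i < k + l) → rel XY i s j t ≡ false
  across′ k≤i j<k (yes i<k+l) = trans (inside i<k+l (widen j<k))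
    (cong₂ (combine R S) (part-right k l i<k+l k≤i s) (part-left k l (widen j<k) j<k t))
  across′ _ _ (no i≮k+l) = rel-outsideˡ XY s t i≮k+l

  byBlocks : Dec (i < k) → Dec (j < k) → rel XY i s j t ≡ (rel X ⊗⟨ k ⟩ rel Y) i s j t
  byBlocks (yes i<k) (yes j<k) =
    trans (leftBlock i<k j<k) (sym (⊗-left (rel X) (rel Y) i<k j<k))
  byBlocks (no i≮k) (no j≮k) =
    trans (rightBlock (≮⇒≥ i≮k) (≮⇒≥ j≮k) (i <? k + l) (j <? k + l))
          (sym (⊗-right (rel X) (rel Y) (≮⇒≥ i≮k) (≮⇒≥ j≮k)))
  byBlocks (yes i<k) (no j≮k) =
    trans (across i<k (≮⇒≥ j≮k) (j <? k + l)) (sym (⊗-across (rel X) (rel Y) i<k (≮⇒≥ j≮k)))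
  byBlocks (no i≮k) (yes j<k) =
    trans (across′ (≮⇒≥ i≮k) j<k (i <? k + l)) (sym (⊗-across′ (rel X) (rel Y) (≮⇒≥ i≮k) j<k))

rel-∅ : rel ∅A ≋ ∅ᴿ
rel-∅ = isDiagRel-∅ (rel-isDiagRel ∅A)

⊗-identityˡ : ∀ B → ∅ᴿ ⊗⟨ 0 ⟩ B ≋ B
⊗-identityˡ B i s j t = ⊗-right ∅ᴿ B z≤n z≤n

⊗-identityʳ : ∀ {k A} → IsDiagRel k A → A ⊗⟨ k ⟩ ∅ᴿ ≋ A
⊗-identityʳ {k} {A} isA i s j t with i <? k | j <? k
... | yes _   | yes _   = refl
... | yes _   | no j≮k  = sym (IsDiagRel.outsideʳ isA s t j≮k)
... | no i≮k  | yes _   = sym (IsDiagRel.outsideˡ isA s t i≮k)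
... | no i≮k  | no _    = sym (IsDiagRel.outsideˡ isA s t i≮k)

data Position (k l i : ℕ) : Set where
  first  : i < k → Position k l i
  second : k ≤ i → i < k + l → Position k l i
  third  : k + l ≤ i → Position k l i

position : ∀ k l i → Position k l i
position k l i with i <? k | i <? k + l
... | yes i<k | _         = first i<k
... | no i≮k  | yes i<k+l = second (≮⇒≥ i≮k) i<k+l
... | no _    | no i≮k+l  = third (≮⇒≥ i≮k+l)

⊗-assoc : ∀ k l A B C → A ⊗⟨ k ⟩ (B ⊗⟨ l ⟩ C) ≋ (A ⊗⟨ k ⟩ B) ⊗⟨ k + l ⟩ C
⊗-assoc k l A B C i s j t = byPositions (position k l i) (position k l j)
  where
  BC = B ⊗⟨ l ⟩ C
  AB = A ⊗⟨ k ⟩ B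
  widen : ∀ {x} → x < k → x < k + l
  widen x<k = <-≤-trans x<k (m≤m+n k l)
  narrow : ∀ {x} → k + l ≤ x → k ≤ x
  narrow k+l≤x = ≤-trans (m≤m+n k l) k+l≤x
  inner : ∀ {x} → k ≤ x → x < k + l → x ∸ k < l
  inner = n≤m⇒m<n+o⇒m∸n<o
  past : ∀ {x} → k + l ≤ x → l ≤ x ∸ k
  past {x} k+l≤x = subst (_≤ x ∸ k) (m+n∸m≡n k l) (∸-monoˡ-≤ k k+l≤x)
  byPositions : Position k l i → Position k l j → (A ⊗⟨ k ⟩ BC) i s j t ≡ (AB ⊗⟨ k + l ⟩ C) i s j t
  byPositions (first i<k) (first j<k) =
    trans (⊗-left A BC i<k j<k) (sym (trans (⊗-left AB C (widen i<k) (widen j<k)) (⊗-left A B i<k j<k)))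
  byPositions (first i<k) (second k≤j j<k+l) =
    trans (⊗-across A BC i<k k≤j) (sym (trans (⊗-left AB C (widen i<k) j<k+l) (⊗-across A B i<k k≤j)))
  byPositions (first i<k) (third k+l≤j) =
    trans (⊗-across A BC i<k (narrow k+l≤j)) (sym (⊗-across AB C (widen i<k) k+l≤j))
  byPositions (second k≤i i<k+l) (first j<k) =
    trans (⊗-across′ A BC k≤i j<k) (sym (trans (⊗-left AB C i<k+l (widen j<k)) (⊗-across′ A B k≤i j<k)))
  byPositions (second k≤i i<k+l) (second k≤j j<k+l) =
    trans (⊗-right A BC k≤i k≤j) (trans (⊗-left B C (inner k≤i i<k+l) (inner k≤j j<k+l))
      (sym (trans (⊗-left AB C i<k+l j<k+l) (⊗-right A B k≤i k≤j))))
  byPositions (second k≤i i<k+l) (third k+l≤j) =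
    trans (⊗-right A BC k≤i (narrow k+l≤j)) (trans (⊗-across B C (inner k≤i i<k+l) (past k+l≤j))
      (sym (⊗-across AB C i<k+l k+l≤j)))
  byPositions (third k+l≤i) (first j<k) =
    trans (⊗-across′ A BC (narrow k+l≤i) j<k) (sym (⊗-across′ AB C k+l≤i (widen j<k)))
  byPositions (third k+l≤i) (second k≤j j<k+l) =
    trans (⊗-right A BC (narrow k+l≤i) k≤j) (trans (⊗-across′ B C (past k+l≤i) (inner k≤j j<k+l))
      (sym (⊗-across′ AB C k+l≤i j<k+l)))
  byPositions (third k+l≤i) (third k+l≤j) =
    trans (⊗-right A BC (narrow k+l≤i) (narrow k+l≤j)) (trans (⊗-right B C (past k+l≤i) (past k+l≤j))
      (trans (cong₂ (λ x y → C x s y t) (∸-+-assoc i k l) (∸-+-assoc j k l)) (sym (⊗-right AB C k+l≤i k+l≤j))))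

⊗A-cong : ∀ {X X′ Y Y′} → X ≈ᴰ X′ → Y ≈ᴰ Y′ → X ⊗A Y ≈ᴰ X′ ⊗A Y′
⊗A-cong {X} {X′} {Y} {Y′} eX eY = begin
  rel (X ⊗A Y)                       ≈⟨ rel-⊗ X Y ⟩
  rel X ⊗⟨ order X ⟩ rel Y           ≈⟨ ⊗-cong (order X) eX eY ⟩
  rel X′ ⊗⟨ order X ⟩ rel Y′         ≡⟨ cong (λ k → rel X′ ⊗⟨ k ⟩ rel Y′) (order-resp {X} {X′} eX) ⟩
  rel X′ ⊗⟨ order X′ ⟩ rel Y′        ≈⟨ rel-⊗ X′ Y′ ⟨
  rel (X′ ⊗A Y′)                     ∎
  where open ≋-Reasoning

⊗A-assoc : ∀ X Y Z → X ⊗A (Y ⊗A Z) ≈ᴰ (X ⊗A Y) ⊗A Z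
⊗A-assoc X Y Z = begin
  rel (X ⊗A (Y ⊗A Z))                                          ≈⟨ rel-⊗ X (Y ⊗A Z) ⟩
  rel X ⊗⟨ order X ⟩ rel (Y ⊗A Z)                              ≈⟨ ⊗-cong (order X) ≋-refl (rel-⊗ Y Z) ⟩
  rel X ⊗⟨ order X ⟩ (rel Y ⊗⟨ order Y ⟩ rel Z)                ≈⟨ ⊗-assoc (order X) (order Y) (rel X) (rel Y) (rel Z) ⟩
  (rel X ⊗⟨ order X ⟩ rel Y) ⊗⟨ order X + order Y ⟩ rel Z      ≈⟨ ⊗-cong (order X + order Y) (rel-⊗ X Y) ≋-refl ⟨
  rel (X ⊗A Y) ⊗⟨ order (X ⊗A Y) ⟩ rel Z                       ≈⟨ rel-⊗ (X ⊗A Y) Z ⟨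
  rel ((X ⊗A Y) ⊗A Z)                                          ∎
  where open ≋-Reasoning

⊗A-identityˡ : ∀ Y → ∅A ⊗A Y ≈ᴰ Y
⊗A-identityˡ Y = ≋-trans (rel-⊗ ∅A Y) (≋-trans (⊗-cong 0 rel-∅ ≋-refl) (⊗-identityˡ (rel Y)))

⊗A-identityʳ : ∀ X → X ⊗A ∅A ≈ᴰ X
⊗A-identityʳ X = ≋-trans (rel-⊗ X ∅A) (≋-trans (⊗-cong (order X) ≋-refl rel-∅) (⊗-identityʳ (rel-isDiagRel X)))

-- Definitionally Setup.evalWord, which needs a field only because it is declared in Setup.
⨂ : List Gen → ADiag
⨂ = foldr (λ g d → proj₁ g ⊗A d) ∅A

⨂-++ : ∀ u w → ⨂ (u ++ w) ≈ᴰ ⨂ u ⊗A ⨂ w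
⨂-++ [] w = ≋-sym (⊗A-identityˡ (⨂ w))
⨂-++ (g ∷ u) w =
  ≋-trans (⊗A-cong {proj₁ g} {proj₁ g} {⨂ (u ++ w)} {⨂ u ⊗A ⨂ w} ≋-refl (⨂-++ u w)) (⊗A-assoc (proj₁ g) (⨂ u) (⨂ w))

infix 4 _≈ᵂ_
_≈ᵂ_ : List Gen → List Gen → Set
_≈ᵂ_ = Pointwise (λ g h → proj₁ g ≈ᴰ proj₁ h)

⨂-cong : ∀ {u w} → u ≈ᵂ w → ⨂ u ≈ᴰ ⨂ w
⨂-cong [] = ≋-refl
⨂-cong {g ∷ u} {h ∷ w} (g≈h ∷ u≈w) = ⊗A-cong {proj₁ g} {proj₁ h} {⨂ u} {⨂ w} g≈h (⨂-cong u≈w)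

-- Splits and irreducibility

SplitsAt : ℕ → PtRel → Set
SplitsAt j A = ∀ {i i′} s t → i < j → j ≤ i′ → A i s i′ t ≡ false

HasProperSplit : ℕ → PtRel → Set
HasProperSplit m A = ∃[ j ] j < m × 0 < j × SplitsAt j A

splitsAt-resp : ∀ {j A B} → A ≋ B → SplitsAt j A → SplitsAt j B
splitsAt-resp e sp s t i<j j≤i′ = trans (sym (e _ s _ t)) (sp s t i<j j≤i′)

hasProperSplit-resp : ∀ {m A B} → A ≋ B → HasProperSplit m A → HasProperSplit m B
hasProperSplit-resp e (j , j<m , 0<j , sp) = j , j<m , 0<j , splitsAt-resp e sp

⊗-splitsAt : ∀ k A B → SplitsAt k (A ⊗⟨ k ⟩ B)
⊗-splitsAt k A B s t = ⊗-across A B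

splitsAt-⊗ˡ : ∀ {k j B} C → IsDiagRel k B → j ≤ k → SplitsAt j (B ⊗⟨ k ⟩ C) → SplitsAt j B
splitsAt-⊗ˡ {k} {j} {B} C isB j≤k sp {i} {i′} s t i<j j≤i′ with i′ <? k
... | yes i′<k = trans (sym (⊗-left B C (<-≤-trans i<j j≤k) i′<k)) (sp s t i<j j≤i′)
... | no i′≮k = IsDiagRel.outsideʳ isB s t i′≮k

restrict : ℕ → PtRel → PtRel
restrict j A = A ⊗⟨ j ⟩ ∅ᴿ

shift : ℕ → PtRel → PtRel
shift j A i s i′ t = A (i + j) s (i′ + j) t

isDiagRel-restrict : ∀ {m A} j → IsDiagRel m A → j ≤ m → IsDiagRel j (restrict j A)
isDiagRel-restrict {m} {A} j isA j≤m = record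
  { reflexive = λ s i<j → subst T (sym (⊗-left A ∅ᴿ i<j i<j)) (reflexive s (<-≤-trans i<j j≤m))
  ; symmetric = λ s t h → let (i<j , i′<j , h′) = inside s t h in
      subst T (sym (⊗-left A ∅ᴿ i′<j i<j)) (symmetric s t h′)
  ; transitive = λ s t u h g → let (i<j , _ , h′) = inside s t h ; (_ , l<j , g′) = inside t u g in
      subst T (sym (⊗-left A ∅ᴿ i<j l<j)) (transitive s t u h′ g′)
  ; supported = λ s t h → proj₁ (inside s t h) }
  where
  open IsDiagRel isA
  inside : ∀ {i i′} s t → T (restrict j A i s i′ t) → i < j × i′ < j × T (A i s i′ t)
  inside {i} {i′} s t = byBlocks (i <? j) (i′ <? j)
    where
    byBlocks : Dec (i < j) → Dec (i′ < j) → T (restrict j A i s i′ t) → i < j × i′ < j × T (A i s i′ t)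
    byBlocks (yes i<j) (yes i′<j) h = i<j , i′<j , subst T (⊗-left A ∅ᴿ i<j i′<j) h
    byBlocks (yes i<j) (no i′≮j) h = ⊥-elim (subst T (⊗-across A ∅ᴿ i<j (≮⇒≥ i′≮j)) h)
    byBlocks (no i≮j) (yes i′<j) h = ⊥-elim (subst T (⊗-across′ A ∅ᴿ (≮⇒≥ i≮j) i′<j) h)
    byBlocks (no i≮j) (no i′≮j) h = ⊥-elim (subst T (⊗-right A ∅ᴿ (≮⇒≥ i≮j) (≮⇒≥ i′≮j)) h)

isDiagRel-shift : ∀ {m A} j → IsDiagRel m A → j ≤ m → IsDiagRel (m ∸ j) (shift j A)
isDiagRel-shift {m} {A} j isA j≤m = record
  { reflexive = λ {i} s i<m∸j → reflexive s (m≤o∸n⇒m+n≤o (suc i) j≤m i<m∸j)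
  ; symmetric = λ s t → symmetric s t
  ; transitive = λ s t u → transitive s t u
  ; supported = λ {i} s t h → m+n≤o⇒m≤o∸n (suc i) (supported s t h) }
  where open IsDiagRel isA

splitsAt-across′ : ∀ {m A j} → IsDiagRel m A → SplitsAt j A → ∀ {i i′} s t → j ≤ i → i′ < j → A i s i′ t ≡ false
splitsAt-across′ {A = A} isA sp {i} {i′} s t j≤i i′<j with A i s i′ t in eq
... | false = refl
... | true = ⊥-elim (subst T (sp t s i′<j j≤i) (IsDiagRel.symmetric isA s t (subst T (sym eq) tt)))

splitsAt-decompose : ∀ {m A j} → IsDiagRel m A → SplitsAt j A → A ≋ restrict j A ⊗⟨ j ⟩ shift j A
splitsAt-decompose {A = A} {j} isA sp i s i′ t with i <? j | i′ <? j
... | yes i<j | yes i′<j = sym (⊗-left A ∅ᴿ i<j i′<j)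
... | yes i<j | no i′≮j = sp s t i<j (≮⇒≥ i′≮j)
... | no i≮j | yes i′<j = splitsAt-across′ isA sp s t (≮⇒≥ i≮j) i′<j
... | no i≮j | no i′≮j = sym (cong₂ (λ x y → A x s y t) (m∸n+n≡m (≮⇒≥ i≮j)) (m∸n+n≡m (≮⇒≥ i′≮j)))

restrict-⊗ : ∀ {k B} C → IsDiagRel k B → restrict k (B ⊗⟨ k ⟩ C) ≋ B
restrict-⊗ {k} {B} C isB i s j t = byBlocks (i <? k) (j <? k)
  where
  BC = B ⊗⟨ k ⟩ C
  byBlocks : Dec (i < k) → Dec (j < k) → restrict k BC i s j t ≡ B i s j t
  byBlocks (yes i<k) (yes j<k) = trans (⊗-left BC ∅ᴿ i<k j<k) (⊗-left B C i<k j<k)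
  byBlocks (yes i<k) (no j≮k) = trans (⊗-across BC ∅ᴿ i<k (≮⇒≥ j≮k)) (sym (IsDiagRel.outsideʳ isB s t j≮k))
  byBlocks (no i≮k) (yes j<k) = trans (⊗-across′ BC ∅ᴿ (≮⇒≥ i≮k) j<k) (sym (IsDiagRel.outsideˡ isB s t i≮k))
  byBlocks (no i≮k) (no j≮k) = trans (⊗-right BC ∅ᴿ (≮⇒≥ i≮k) (≮⇒≥ j≮k)) (sym (IsDiagRel.outsideˡ isB s t i≮k))

shift-⊗ : ∀ k B C → shift k (B ⊗⟨ k ⟩ C) ≋ C
shift-⊗ k B C i s j t =
  trans (⊗-right B C (m≤n+m k i) (m≤n+m k j)) (cong₂ (λ x y → C x s y t) (m+n∸n≡m i k) (m+n∸n≡m j k))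

⊗-cancel : ∀ {k k′ A A′ B B′} → IsDiagRel k A → IsDiagRel k′ A′ → k ≡ k′ →
           A ⊗⟨ k ⟩ B ≋ A′ ⊗⟨ k′ ⟩ B′ → A ≋ A′ × B ≋ B′
⊗-cancel {k} {_} {A} {A′} {B} {B′} isA isA′ refl e =
  ≋-trans (≋-sym (restrict-⊗ B isA)) (≋-trans (⊗-cong k e ≋-refl) (restrict-⊗ B′ isA′)) ,
  ≋-trans (≋-sym (shift-⊗ k A B)) (≋-trans (λ i s j t → e (i + k) s (j + k) t) (shift-⊗ k A′ B′))

nonempty : ∀ {k} (π : Diagram k) → 0 < k → Nonempty (k , π)
nonempty {suc k} π _ = tt

nonempty⇒0<order : ∀ X → Nonempty X → 0 < order X
nonempty⇒0<order (suc k , _) _ = s≤s z≤n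

irreducible⇔noProperSplit : ∀ X → Irreducible X ⇔ (¬ HasProperSplit (order X) (rel X))
irreducible⇔noProperSplit X = mk⇔ noSplit irreducible
  where
  isX = rel-isDiagRel X
  m = order X

  noSplit : Irreducible X → ¬ HasProperSplit m (rel X)
  noSplit irr (j , j<m , 0<j , sp) =
    irr (ρ₁ , ρ₂ , nonempty _ 0<j , nonempty _ (m<n⇒0<n∸m j<m) , Equivalence.from (≐⇔≈ᴰ X (ρ₁ ⊗A ρ₂)) split)
    where
    isRestrict = isDiagRel-restrict j isX (<⇒≤ j<m)
    isShift = isDiagRel-shift j isX (<⇒≤ j<m)
    ρ₁ ρ₂ : ADiag
    ρ₁ = j , diagramOf isRestrict
    ρ₂ = m ∸ j , diagramOf isShift
    split : X ≈ᴰ ρ₁ ⊗A ρ₂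
    split = begin
      rel X                                    ≈⟨ splitsAt-decompose isX sp ⟩
      restrict j (rel X) ⊗⟨ j ⟩ shift j (rel X) ≈⟨ ⊗-cong j (rel-diagramOf isRestrict) (rel-diagramOf isShift) ⟨
      rel ρ₁ ⊗⟨ j ⟩ rel ρ₂                      ≈⟨ rel-⊗ ρ₁ ρ₂ ⟨
      rel (ρ₁ ⊗A ρ₂)                            ∎
      where open ≋-Reasoning

  irreducible : ¬ HasProperSplit m (rel X) → Irreducible X
  irreducible noSp (ρ₁ , ρ₂ , ne₁ , ne₂ , X≐ρ₁⊗ρ₂) = noSp (order ρ₁ , ρ₁<X , nonempty⇒0<order ρ₁ ne₁ , sp)
    where
    e : X ≈ᴰ ρ₁ ⊗A ρ₂
    e = Equivalence.to (≐⇔≈ᴰ X (ρ₁ ⊗A ρ₂)) X≐ρ₁⊗ρ₂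
    ρ₁<X : order ρ₁ < m
    ρ₁<X = subst (order ρ₁ <_) (sym (order-resp {X} {ρ₁ ⊗A ρ₂} e)) (m<m+n (order ρ₁) (nonempty⇒0<order ρ₂ ne₂))
    sp : SplitsAt (order ρ₁) (rel X)
    sp = splitsAt-resp (≋-sym (≋-trans e (rel-⊗ ρ₁ ρ₂))) (⊗-splitsAt (order ρ₁) (rel ρ₁) (rel ρ₂))

∀-Bool? : {P : Bool → Set} → (∀ b → Dec (P b)) → Dec (∀ b → P b)
∀-Bool? P? = map′ (λ (pf , pt) → λ { false → pf ; true → pt }) (λ p → p false , p true) (P? false ×-dec P? true)

splitsAt? : ∀ {m A} → IsDiagRel m A → ∀ j → Dec (SplitsAt j A)
splitsAt? {m} {A} isA j = map′ fromBounded toBounded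
  (allUpTo? (λ i → allUpTo? (λ i′ → j ≤? i′ →-dec ∀-Bool? λ s → ∀-Bool? λ t → A i s i′ t ≟ᵇ false) m) j)
  where
  Bounded : Set
  Bounded = ∀ {i} → i < j → ∀ {i′} → i′ < m → j ≤ i′ → ∀ s t → A i s i′ t ≡ false
  fromBounded : Bounded → SplitsAt j A
  fromBounded b {i} {i′} s t i<j j≤i′ with i′ <? m
  ... | yes i′<m = b i<j i′<m j≤i′ s t
  ... | no i′≮m = IsDiagRel.outsideʳ isA s t i′≮m
  toBounded : SplitsAt j A → Bounded
  toBounded sp i<j _ j≤i′ s t = sp s t i<j j≤i′

hasProperSplit? : ∀ {m A} → IsDiagRel m A → Dec (HasProperSplit m A)
hasProperSplit? {m} isA = anyUpTo? (λ j → 0 <? j ×-dec splitsAt? isA j) m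

-- Unique factorisation into irreducible diagrams

Factorisation : ℕ → Set
Factorisation m = ∀ A → IsDiagRel m A → ∃[ w ] A ≋ rel (⨂ w)

factorisation : ∀ m → Factorisation m
factorisation = <-rec Factorisation factor
  where
  factor : ∀ m → (∀ {j} → j < m → Factorisation j) → Factorisation m
  factor zero _ A isA = [] , ≋-trans (isDiagRel-∅ isA) (≋-sym rel-∅)
  factor m@(suc _) rec A isA with hasProperSplit? isA
  ... | yes (j , j<m , 0<j , sp) =
    let j≤m = <⇒≤ j<m
        isRestrict = isDiagRel-restrict j isA j≤m
        (u , eu) = rec j<m (restrict j A) isRestrict
        (w , ew) = rec (∸-monoʳ-< 0<j j≤m) (shift j A) (isDiagRel-shift j isA j≤m)
        open ≋-Reasoning
    in u ++ w , (begin
      A                                    ≈⟨ splitsAt-decompose isA sp ⟩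
      restrict j A ⊗⟨ j ⟩ shift j A        ≈⟨ ⊗-cong j eu ew ⟩
      rel (⨂ u) ⊗⟨ j ⟩ rel (⨂ w)           ≡⟨ cong (λ k → rel (⨂ u) ⊗⟨ k ⟩ rel (⨂ w)) (isDiagRel-order (⨂ u) isRestrict eu) ⟨
      rel (⨂ u) ⊗⟨ order (⨂ u) ⟩ rel (⨂ w) ≈⟨ rel-⊗ (⨂ u) (⨂ w) ⟨
      rel (⨂ u ⊗A ⨂ w)                     ≈⟨ ⨂-++ u w ⟨
      rel (⨂ (u ++ w))                     ∎)
  ... | no noSplit = (X , tt , irreducible) ∷ [] , ≋-sym (≋-trans (⊗A-identityʳ X) (rel-diagramOf isA))
    where
    X : ADiag
    X = m , diagramOf isA
    irreducible : Irreducible X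
    irreducible = Equivalence.from (irreducible⇔noProperSplit X) (noSplit ∘ hasProperSplit-resp (rel-diagramOf isA))

first-factor-not-shorter : ∀ (g h : Gen) {U W} →
  rel (proj₁ g) ⊗⟨ order (proj₁ g) ⟩ U ≋ rel (proj₁ h) ⊗⟨ order (proj₁ h) ⟩ W →
  ¬ order (proj₁ g) < order (proj₁ h)
first-factor-not-shorter (G , G-nonempty , _) (H , _ , H-irreducible) {U} {W} e G<H =
  Equivalence.to (irreducible⇔noProperSplit H) H-irreducible
    (order G , G<H , nonempty⇒0<order G G-nonempty , splitsAt-⊗ˡ W (rel-isDiagRel H) (<⇒≤ G<H)
      (splitsAt-resp e (⊗-splitsAt (order G) (rel G) U)))

factorisation-unique : ∀ u w → ⨂ u ≈ᴰ ⨂ w → u ≈ᵂ w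
factorisation-unique [] [] _ = []
factorisation-unique [] (h@((suc _ , _) , _) ∷ w) e with order-resp {⨂ []} {⨂ (h ∷ w)} e
... | ()
factorisation-unique (g@((suc _ , _) , _) ∷ u) [] e with order-resp {⨂ (g ∷ u)} {⨂ []} e
... | ()
factorisation-unique (g ∷ u) (h ∷ w) e = byOrders (<-cmp (order G) (order H))
  where
  G = proj₁ g
  H = proj₁ h
  blocks : rel G ⊗⟨ order G ⟩ rel (⨂ u) ≋ rel H ⊗⟨ order H ⟩ rel (⨂ w)
  blocks = ≋-trans (≋-sym (rel-⊗ G (⨂ u))) (≋-trans e (rel-⊗ H (⨂ w)))
  byOrders : Tri (order G < order H) (order G ≡ order H) (order H < order G) → g ∷ u ≈ᵂ h ∷ w
  byOrders (tri< G<H _ _) = ⊥-elim (first-factor-not-shorter g h blocks G<H)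
  byOrders (tri> _ _ H<G) = ⊥-elim (first-factor-not-shorter h g (≋-sym blocks) H<G)
  byOrders (tri≈ _ |G|≡|H| _) =
    let (G≈H , u≈w) = ⊗-cancel (rel-isDiagRel G) (rel-isDiagRel H) |G|≡|H| blocks
    in G≈H ∷ factorisation-unique u w u≈w

-- Linear extensions of maps of bases

module FreeVSMaps {c ℓ : Level} (K : Field c ℓ) where
  open Field K using (Carrier) renaming (_+_ to _+K_; _*_ to _*K_)

  Indistinguishable : {B : Set} → (B → B → Bool) → B → B → Set
  Indistinguishable eqB b b′ = ∀ d → eqB d b ≡ eqB d b′

  module _ {B : Set} (eqB : B → B → Bool) where
    open FreeVS K B eqB

    SameTerm : Carrier × B → Carrier × B → Set c
    SameTerm (x , b) (y , b′) = x ≡ y × Indistinguishable eqB b b′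

    coeff-resp : ∀ {v v′} → Pointwise SameTerm v v′ → ∀ d → coeff v d ≡ coeff v′ d
    coeff-resp [] d = refl
    coeff-resp {(x , b) ∷ v} {(.x , b′) ∷ v′} ((refl , b∼b′) ∷ v≃v′) d with eqB d b | eqB d b′ | b∼b′ d
    ... | true  | .true  | refl = cong (x +K_) (coeff-resp v≃v′ d)
    ... | false | .false | refl = coeff-resp v≃v′ d

    ≈V-fromPointwise : ∀ {v v′} → Pointwise SameTerm v v′ → v ≈V v′
    ≈V-fromPointwise v≃v′ d = Field.reflexive K (coeff-resp v≃v′ d)

    coeff-cong : ∀ v {d d′} → (∀ b → eqB d b ≡ eqB d′ b) → coeff v d ≡ coeff v d′
    coeff-cong [] _ = refl
    coeff-cong ((x , b) ∷ v) {d} {d′} d∼d′ with eqB d b | eqB d′ b | d∼d′ b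
    ... | true  | .true  | refl = cong (x +K_) (coeff-cong v d∼d′)
    ... | false | .false | refl = coeff-cong v d∼d′

  module _ {B B′ : Set} (eqB : B → B → Bool) (eqB′ : B′ → B′ → Bool) (f : B → B′) where
    private
      module V = FreeVS K B eqB
      module V′ = FreeVS K B′ eqB′

    coeff-linExt : (g : B′ → B) → (∀ d b → eqB′ d (f b) ≡ eqB (g d) b) →
                   ∀ v d → V′.coeff (V.linExt f v) d ≡ V.coeff v (g d)
    coeff-linExt g adjoint [] d = refl
    coeff-linExt g adjoint ((x , b) ∷ v) d with eqB′ d (f b) | eqB (g d) b | adjoint d b
    ... | true  | .true  | refl = cong (x +K_) (coeff-linExt g adjoint v d)
    ... | false | .false | refl = coeff-linExt g adjoint v d

    linExt-+V : ∀ u v → V.linExt f (u V.+V v) ≡ V.linExt f u V′.+V V.linExt f v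
    linExt-+V = map-++ _

    linExt-·V : ∀ a v → V.linExt f (a V.·V v) ≡ a V′.·V V.linExt f v
    linExt-·V a [] = refl
    linExt-·V a (p ∷ v) = cong (_ ∷_) (linExt-·V a v)

    linExt-mulWith : (m : B → B → B) (m′ : B′ → B′ → B′) →
      (∀ a b → Indistinguishable eqB′ (f (m a b)) (m′ (f a) (f b))) →
      ∀ u v → Pointwise (SameTerm eqB′) (V.linExt f (V.mulWith m u v)) (V′.mulWith m′ (V.linExt f u) (V.linExt f v))
    linExt-mulWith m m′ hom [] v = []
    linExt-mulWith m m′ hom (p ∷ u) v =
      subst (λ z → Pointwise (SameTerm eqB′) z _) (sym (map-++ _ (row p v) (V.mulWith m u v)))
        (PW.++⁺ (linExt-row v) (linExt-mulWith m m′ hom u v))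
      where
      row : Carrier × B → V.Vec → V.Vec
      row p = map (λ q → (proj₁ p *K proj₁ q , m (proj₂ p) (proj₂ q)))
      linExt-row : ∀ v → Pointwise (SameTerm eqB′) (V.linExt f (row p v))
                     (map (λ q → (proj₁ p *K proj₁ q , m′ (f (proj₂ p)) (proj₂ q))) (V.linExt f v))
      linExt-row [] = []
      linExt-row (q ∷ v) = (refl , hom (proj₂ p) (proj₂ q)) ∷ linExt-row v

-- The isomorphism

factorise : ADiag → List Gen
factorise X = proj₁ (factorisation (order X) (rel X) (rel-isDiagRel X))

factorise-correct : ∀ X → X ≈ᴰ ⨂ (factorise X)
factorise-correct X = proj₂ (factorisation (order X) (rel X) (rel-isDiagRel X))

⨂-injective⇔ : ∀ u w → ⨂ u ≈ᴰ ⨂ w ⇔ u ≈ᵂ w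
⨂-injective⇔ u w = mk⇔ (factorisation-unique u w) ⨂-cong

factorise⇔ : ∀ X w → X ≈ᴰ ⨂ w ⇔ factorise X ≈ᵂ w
factorise⇔ X w = mk⇔
  (λ e → factorisation-unique (factorise X) w (≋-trans (≋-sym (factorise-correct X)) e))
  (λ fX≈w → ≋-trans (factorise-correct X) (⨂-cong fX≈w))

eqADiag-respʳ : ∀ X {Y Y′} → Y ≈ᴰ Y′ → eqADiag X Y ≡ eqADiag X Y′
eqADiag-respʳ X {Y} {Y′} e = ⇔→≡ (begin
  eqADiag X Y ≡ true   ≈⟨ eqADiag⇔≈ᴰ X Y ⟩
  X ≈ᴰ Y               ≈⟨ mk⇔ (λ f → ≋-trans f e) (λ f → ≋-trans f (≋-sym e)) ⟩
  X ≈ᴰ Y′              ≈⟨ eqADiag⇔≈ᴰ X Y′ ⟨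
  eqADiag X Y′ ≡ true  ∎)
  where open ⇔-Reasoning

∧≡true⇔ : ∀ {a b} → a ∧ b ≡ true ⇔ (a ≡ true × b ≡ true)
∧≡true⇔ {true} {true} = mk⇔ (λ _ → refl , refl) (λ _ → refl)
∧≡true⇔ {true} {false} = mk⇔ (λ ()) (λ ())
∧≡true⇔ {false} = mk⇔ (λ ()) (λ ())

module _ {c ℓ : Level} (K : Field c ℓ) where
  open Setup K
  open FreeVSMaps K
  open Field K using (_≈_) renaming (refl to ≈-refl; reflexive to ≈-reflexive)

  eqWord⇔≈ᵂ : ∀ u w → eqWord u w ≡ true ⇔ u ≈ᵂ w
  eqWord⇔≈ᵂ [] [] = mk⇔ (λ _ → []) (λ _ → refl)
  eqWord⇔≈ᵂ [] (_ ∷ _) = mk⇔ (λ ()) (λ ())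
  eqWord⇔≈ᵂ (_ ∷ _) [] = mk⇔ (λ ()) (λ ())
  eqWord⇔≈ᵂ (g ∷ u) (h ∷ w) = mk⇔
    (λ eq → let (eqG , equ) = Equivalence.to ∧≡true⇔ eq in
            Equivalence.to (eqADiag⇔≈ᴰ (proj₁ g) (proj₁ h)) eqG ∷ Equivalence.to (eqWord⇔≈ᵂ u w) equ)
    (λ { (g≈h ∷ u≈w) → Equivalence.from ∧≡true⇔
            (Equivalence.from (eqADiag⇔≈ᴰ (proj₁ g) (proj₁ h)) g≈h , Equivalence.from (eqWord⇔≈ᵂ u w) u≈w) })

  eqADiag-⨂ : ∀ X w → eqADiag X (⨂ w) ≡ eqWord (factorise X) w
  eqADiag-⨂ X w = ⇔→≡ (begin
    eqADiag X (⨂ w) ≡ true         ≈⟨ eqADiag⇔≈ᴰ X (⨂ w) ⟩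
    X ≈ᴰ ⨂ w                       ≈⟨ factorise⇔ X w ⟩
    factorise X ≈ᵂ w               ≈⟨ eqWord⇔≈ᵂ (factorise X) w ⟨
    eqWord (factorise X) w ≡ true  ∎)
    where open ⇔-Reasoning

  eqWord-factorise : ∀ u w → eqWord u w ≡ eqWord (factorise (⨂ u)) w
  eqWord-factorise u w = ⇔→≡ (begin
    eqWord u w ≡ true                    ≈⟨ eqWord⇔≈ᵂ u w ⟩
    u ≈ᵂ w                               ≈⟨ ⨂-injective⇔ u w ⟨
    ⨂ u ≈ᴰ ⨂ w                           ≈⟨ factorise⇔ (⨂ u) w ⟩
    factorise (⨂ u) ≈ᵂ w                 ≈⟨ eqWord⇔≈ᵂ (factorise (⨂ u)) w ⟨
    eqWord (factorise (⨂ u)) w ≡ true    ∎)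
    where open ⇔-Reasoning

  coeff-Φ : ∀ u X → PS.coeff (Φ u) X ≡ FA.coeff u (factorise X)
  coeff-Φ = coeff-linExt eqWord eqADiag evalWord factorise eqADiag-⨂

  coeff-via-Φ : ∀ u w → FA.coeff u w ≡ PS.coeff (Φ u) (⨂ w)
  coeff-via-Φ u w = trans (coeff-cong eqWord u (eqWord-factorise w)) (sym (coeff-Φ u (⨂ w)))

  Φ-resp : ∀ u v → u FA.≈V v → Φ u PS.≈V Φ v
  Φ-resp u v u≈v X = subst₂ _≈_ (sym (coeff-Φ u X)) (sym (coeff-Φ v X)) (u≈v (factorise X))

  Φ-injective : ∀ u v → Φ u PS.≈V Φ v → u FA.≈V v
  Φ-injective u v Φu≈Φv w = subst₂ _≈_ (sym (coeff-via-Φ u w)) (sym (coeff-via-Φ v w)) (Φu≈Φv (⨂ w))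

  Φ-+ : ∀ u v → Φ (u FA.+V v) PS.≈V (Φ u PS.+V Φ v)
  Φ-+ u v X = ≈-reflexive (cong (λ z → PS.coeff z X) (linExt-+V eqWord eqADiag evalWord u v))

  Φ-· : ∀ a v → Φ (a FA.·V v) PS.≈V (a PS.·V Φ v)
  Φ-· a v X = ≈-reflexive (cong (λ z → PS.coeff z X) (linExt-·V eqWord eqADiag evalWord a v))

  Φ-* : ∀ u v → Φ (u *F v) PS.≈V (Φ u *P Φ v)
  Φ-* = ≈V-fromPointwise eqADiag ∘₂ linExt-mulWith eqWord eqADiag evalWord _++_ _⊗A_
    (λ u w X → eqADiag-respʳ X (⨂-++ u w))

  Φ-1 : Φ 1F PS.≈V 1P
  Φ-1 X = ≈-refl

  Φ-x : ∀ g → Φ (x g) PS.≈V H (proj₁ g)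
  Φ-x g = ≈V-fromPointwise eqADiag ((refl , λ X → eqADiag-respʳ X (⊗A-identityʳ (proj₁ g))) ∷ [])

  Φ-surjective : ∀ (p : ParSym) → Σ FreeAlg λ u → Φ u PS.≈V p
  Φ-surjective p = map (λ (a , X) → a , factorise X) p , ≈V-fromPointwise eqADiag (Φ-factorise p)
    where
    Φ-factorise : ∀ p → Pointwise (SameTerm eqADiag) (Φ (map (λ (a , X) → a , factorise X) p)) p
    Φ-factorise [] = []
    Φ-factorise ((a , X) ∷ p) = (refl , λ Y → eqADiag-respʳ Y (≋-sym (factorise-correct X))) ∷ Φ-factorise p

theorem2p7 : ∀ {c ℓ : Level} (K : Field c ℓ) → let open Setup K in
    -- Φ is a well-defined k-linear map
    (∀ u v → u FA.≈V v → Φ u PS.≈V Φ v)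
    × (∀ u v → Φ (u FA.+V v) PS.≈V (Φ u PS.+V Φ v))
    × (∀ a v → Φ (a FA.·V v) PS.≈V (a PS.·V Φ v))
    -- Φ is a unital algebra homomorphism sending x_g to H_g
    × (∀ u v → Φ (u *F v) PS.≈V (Φ u *P Φ v))
    × (Φ 1F PS.≈V 1P)
    × (∀ g → Φ (x g) PS.≈V H (proj₁ g))
    -- Φ is bijective
    × (∀ u v → Φ u PS.≈V Φ v → u FA.≈V v)
    × (∀ (p : ParSym) → Σ FreeAlg λ u → Φ u PS.≈V p)
theorem2p7 K =
  Φ-resp K , Φ-+ K , Φ-· K , Φ-* K , Φ-1 K , Φ-x K , Φ-injective K , Φ-surjective K
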